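{- For every nonnegative integer $d$, $b(d,1;1)=d+2$.
   Context: A family of sets is a set $F$ of sets. $F$ has the $[d,1]$-property if $|A\cap B|\le d$ for all distinct $A,B\in F$. A set $X$ with $|X|\le t$ is a $t$-transversal of $F$ if it meets every member of $F$. $F$ has the $t$-property if for every $A\in F$ the family $F\setminus\{A\}$ has a $t$-transversal $X$ with $X\cap A=\emptyset$. $b(d,1;t)$ is the supremum of $|F|$ over all families $F$ with the $[d,1]$-property and the $t$-property. -}

module Defs where

open import Data.Nat using (ℕ; suc; _≤_; _+_)
open import Data.Fin using (Fin)
open import Data.List using (List; length)
open import Data.List.Relation.Unary.Any using (Any)
open import Data.List.Relation.Unary.All using (All)
open import Data.Product using (Σ; _×_)
open import Data.Empty using (⊥)
open import Relation.Nullary using (¬_)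
open import Relation.Binary.PropositionalEquality using (_≡_; _≢_)
open import Function.Definitions using (Injective)

AtMost : {U : Set} → ℕ → (U → Set) → Set
AtMost {U} n P = (g : Fin (suc n) → U) → Injective _≡_ _≡_ g → (∀ k → P (g k)) → ⊥

CardAtMost : ℕ → Set → Set
CardAtMost n I = (g : Fin (suc n) → I) → Injective _≡_ _≡_ g → ⊥

-- A family of sets over ground type U is given by an index type I and
-- F : I → (U → Set); it is a *set* of sets, i.e. distinct indices give
-- distinct (extensionally different) sets.
DistinctMembers : {U I : Set} → (I → U → Set) → Set
DistinctMembers {U} {I} F =
  ∀ i j → (∀ x → (F i x → F j x) × (F j x → F i x)) → i ≡ j

D1Property : {U I : Set} → ℕ → (I → U → Set) → Set
D1Property {U} {I} d F = ∀ i j → i ≢ j → AtMost d (λ x → F i x × F j x)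

IsTransversalWithout : {U I : Set} → ℕ → (I → U → Set) → I → List U → Set
IsTransversalWithout {U} {I} t F i X =
  length X ≤ t × (∀ j → j ≢ i → Any (F j) X)

TProperty : {U I : Set} → ℕ → (I → U → Set) → Set
TProperty {U} {I} t F =
  ∀ i → Σ (List U) λ X → IsTransversalWithout t F i X × All (λ x → ¬ F i x) X

module Submission where

-- In a family with the 1-property every member A (other than
-- the only one) has a *private point*: the single point of a 1-transversal of
-- the other members that avoids A.  It lies outside A and inside every other
-- member, so distinct members have distinct private points.  Given d + 3
-- distinct members A₀, A₁, A₂, …, A_{d+2}, the private points of A₂, …, A_{d+2}
-- are d + 1 distinct points of A₀ ∩ A₁, contradicting the [d,1]-property.
--
-- The complements of the singletons of a (d+2)-element set form
-- an extremal family: {i} is a 1-transversal of the others avoiding the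
-- complement of {i}, and two such complements meet in d points.  The last fact
-- is proved by relabelling along punchOut: an injection into the complement of
-- two points of Fin (d+2) becomes an injection into Fin d.

open import Defs
open import Data.Nat using (ℕ; suc; _+_; s≤s; z≤n)
open import Data.Nat.Properties using (+-comm; 1+n≰n)
open import Data.Fin using (Fin; punchOut; _≟_) renaming (zero to fzero; suc to fsuc)
open import Data.Fin.Properties using (punchOut-injective; injective⇒≤; suc-injective)
open import Data.Product using (Σ; _×_; _,_; proj₁; proj₂)
open import Data.List using ([]; _∷_)
open import Data.List.Relation.Unary.Any using (Any; here; there)
open import Data.List.Relation.Unary.All using ([]; _∷_)
open import Data.Empty using (⊥-elim)
open import Relation.Nullary using (¬_; yes; no; contradiction)
open import Relation.Binary.Definitions using (DecidableEquality)
open import Relation.Binary.PropositionalEquality using (_≡_; _≢_; refl; sym; subst)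
open import Function.Definitions using (Injective)

module PrivatePoints {U I : Set} (F : I → U → Set) where

  PrivatePoint : I → U → Set
  PrivatePoint i x = ¬ F i x × (∀ j → j ≢ i → F j x)

  -- Under the 1-property, a member with at least one other member j has a
  -- private point: its transversal of the others is nonempty (it meets F j),
  -- has length ≤ 1, and avoids F i.
  privatePoint : TProperty 1 F → ∀ i j → j ≢ i → Σ U (PrivatePoint i)
  privatePoint T i j j≢i with T i
  ... | [] , (_ , meets) , _ with meets j j≢i
  ...   | ()
  privatePoint T i j j≢i | x ∷ [] , (_ , meets) , (x∉Fi ∷ []) =
    x , x∉Fi , λ k k≢i → the-point (meets k k≢i)
    where
    the-point : {P : U → Set} → Any P (x ∷ []) → P x
    the-point (here p) = p
    the-point (there ())
  privatePoint T i j j≢i | _ ∷ _ ∷ _ , (s≤s () , _) , _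

  -- Distinct members have distinct private points: the private point of i
  -- lies in F i' while that of i' does not.
  privatePoint-distinct : ∀ {i i' x x'} → PrivatePoint i x → PrivatePoint i' x' →
                          i ≢ i' → x ≢ x'
  privatePoint-distinct (_ , x∈others) (x'∉Fi' , _) i≢i' x≡x' =
    x'∉Fi' (subst (F _) x≡x' (x∈others _ (λ i'≡i → i≢i' (sym i'≡i))))

-- The private points of members 2, …, d+2 of an injective
-- enumeration are d + 1 distinct points common to members 0 and 1.
upperBound : {U I : Set} (d : ℕ) (F : I → U → Set) →
             D1Property d F → TProperty 1 F → CardAtMost (suc (suc d)) I
upperBound {U} {I} d F D1 T g g-inj =
  D1 (g fzero) (g (fsuc fzero)) (λ e → 0≢1 (g-inj e)) p p-injective p∈A₀∩A₁
  where
  open PrivatePoints F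

  0≢1 : fzero ≢ fsuc {suc (suc d)} fzero
  0≢1 ()

  A : Fin (suc d) → I
  A k = g (fsuc (fsuc k))

  A₀≢A : ∀ k → g fzero ≢ A k
  A₀≢A k e with g-inj e
  ... | ()

  A₁≢A : ∀ k → g (fsuc fzero) ≢ A k
  A₁≢A k e with g-inj e
  ... | ()

  private-of-A : ∀ k → Σ U (PrivatePoint (A k))
  private-of-A k = privatePoint T (A k) (g fzero) (A₀≢A k)

  p : Fin (suc d) → U
  p k = proj₁ (private-of-A k)

  p-injective : Injective _≡_ _≡_ p
  p-injective {a} {b} pa≡pb with a ≟ b
  ... | yes a≡b = a≡b
  ... | no a≢b = contradiction pa≡pb
        (privatePoint-distinct (proj₂ (private-of-A a)) (proj₂ (private-of-A b))
          (λ e → a≢b (suc-injective (suc-injective (g-inj e)))))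

  p∈A₀∩A₁ : ∀ k → F (g fzero) (p k) × F (g (fsuc fzero)) (p k)
  p∈A₀∩A₁ k = proj₂ (proj₂ (private-of-A k)) _ (A₀≢A k)
            , proj₂ (proj₂ (private-of-A k)) _ (A₁≢A k)

punchOut-injection : {m n : ℕ} {i : Fin (suc n)} (g : Fin m → Fin (suc n)) →
                     Injective _≡_ _≡_ g → (misses : ∀ k → i ≢ g k) →
                     Injective _≡_ _≡_ (λ k → punchOut (misses k))
punchOut-injection g g-inj misses e =
  g-inj (punchOut-injective (misses _) (misses _) e)

twoPointComplement-atMost : {n : ℕ} (i j : Fin (suc (suc n))) → i ≢ j →
                            AtMost n (λ x → x ≢ i × x ≢ j)
twoPointComplement-atMost {n} i j i≢j g g-inj avoids =
  1+n≰n (injective⇒≤ (punchOut-injection g₁ g₁-inj misses-j'))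
  where
  misses-i : ∀ k → i ≢ g k
  misses-i k e = proj₁ (avoids k) (sym e)

  g₁ : Fin (suc n) → Fin (suc n)
  g₁ k = punchOut (misses-i k)

  g₁-inj : Injective _≡_ _≡_ g₁
  g₁-inj = punchOut-injection g g-inj misses-i

  misses-j' : ∀ k → punchOut i≢j ≢ g₁ k
  misses-j' k e = proj₂ (avoids k) (sym (punchOut-injective i≢j (misses-i k) e))

module SingletonComplements {U : Set} (_≟U_ : DecidableEquality U) where

  Co : U → U → Set
  Co i x = x ≢ i

  -- Complements of distinct points differ at those points.
  distinct : DistinctMembers Co
  distinct i j same with i ≟U j
  ... | yes i≡j = i≡j
  ... | no i≢j = ⊥-elim (proj₂ (same i) i≢j refl)

  oneProperty : TProperty 1 Co
  oneProperty i = (i ∷ []) , (s≤s z≤n , λ j j≢i → here (λ i≡j → j≢i (sym i≡j)))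
                , ((λ i≢i → i≢i refl) ∷ [])

complements-D1 : (d : ℕ) → D1Property d (SingletonComplements.Co (_≟_ {suc (suc d)}))
complements-D1 d = twoPointComplement-atMost

lemma2 : (d : ℕ) →
    ((U I : Set) (F : I → U → Set) → DistinctMembers F → D1Property d F →
    TProperty 1 F → CardAtMost (d + 2) I)
    × Σ Set (λ U → Σ (Fin (d + 2) → U → Set) (λ F →
    DistinctMembers F × D1Property d F × TProperty 1 F))
lemma2 d rewrite +-comm d 2 =
  (λ U I F _ D1 T → upperBound d F D1 T)
  , Fin (suc (suc d)) , Co , distinct , complements-D1 d , oneProperty
  where open SingletonComplements (_≟_ {suc (suc d)})
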